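{- Define the integer polynomial map $T:\mathbb{A}^3_{\mathbb{Z}}\to\mathbb{A}^3_{\mathbb{Z}}$ by \[T(x,y,z)=\big((x+z)(x-y)z,\ (y+2z)(x-y)z,\ (x-y)z^2\big),\] and let $Y$ be the subscheme defined by $x+z=y$. Then for every prime $p$, the reduction modulo $p$ of the iterate $T^{(p+1)}$ contracts the reduction modulo $p$ of $Y$ to the point $(0,0,0)$; that is, for every point $(x_0,y_0,z_0)\in\overline{\mathbb{F}}_p^{\,3}$ with $x_0+z_0=y_0$, applying the reduction of $T$ modulo $p$ exactly $p+1$ times to $(x_0,y_0,z_0)$ yields $(0,0,0)$.
   Context: $T^{(k)}$ denotes the $k$-th iterate of $T$; $\overline{\mathbb{F}}_p$ is an algebraic closure of the field with $p$ elements. -}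

module Defs where

open import Level using (Level; _⊔_)
open import Data.Nat using (ℕ; zero; suc)
open import Data.Product using (_×_; _,_; ∃-syntax)
open import Relation.Nullary using (¬_)
open import Algebra.Bundles using (CommutativeRing)

record IsField {c ℓ : Level} (R : CommutativeRing c ℓ) : Set (c ⊔ ℓ) where
  open CommutativeRing R
  field
    nontrivial : ¬ (1# ≈ 0#)
    inverse    : ∀ x → ¬ (x ≈ 0#) → ∃[ y ] (x * y ≈ 1#)

module _ {c ℓ : Level} (R : CommutativeRing c ℓ) where
  open CommutativeRing R

  natR : ℕ → Carrier
  natR zero    = 0#
  natR (suc n) = 1# + natR n

  -- R has characteristic p (for p prime this is just p · 1 = 0)
  HasChar : ℕ → Set ℓ
  HasChar p = natR p ≈ 0#

  Point : Set c
  Point = Carrier × Carrier × Carrier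

  T : Point → Point
  T (x , y , z) =
    ( ((x + z) * (x - y)) * z
    , ((y + (z + z)) * (x - y)) * z
    , (x - y) * (z * z) )

  iterT : ℕ → Point → Point
  iterT zero    P = P
  iterT (suc k) P = T (iterT k P)

  IsOrigin : Point → Set ℓ
  IsOrigin (a , b , c′) = (a ≈ 0#) × (b ≈ 0#) × (c′ ≈ 0#)

-- Write d = x − y. A direct computation gives, for every m,
--   d(T P) + (1 + m)·z(T P) = d·z·(d + m·z),
-- so T maps the plane d + n·z = 0 into the plane d + (n + 1)·z = 0, and Y is the
-- plane with n = 1. After p − 1 steps a point of Y therefore satisfies d + p·z = 0,
-- i.e. d = 0 in characteristic p; one more step sends such a point to the origin,
-- which T fixes.
module Submission where

open import Defs
open import Data.Nat using (ℕ; zero; suc)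
open import Data.Nat.Primality using (Prime)
open import Data.Product using (_,_)
open import Algebra.Bundles using (CommutativeRing)
open import Level using (Level)
import Algebra.Properties.AbelianGroup as AbelianGroupProperties
import Algebra.Properties.CommutativeSemigroup as CommutativeSemigroupProperties
import Algebra.Solver.Ring.NaturalCoefficients.Default as NaturalCoefficientsSolver
import Relation.Binary.Reasoning.Setoid as SetoidReasoning

module Contraction {c ℓ : Level} (K : CommutativeRing c ℓ) where
  open CommutativeRing K hiding (zero)
  open AbelianGroupProperties +-abelianGroup using (xyx⁻¹≈y)
  open CommutativeSemigroupProperties +-commutativeSemigroup using (xy∙z≈xz∙y)
  open NaturalCoefficientsSolver commutativeSemiring using (solve; _:=_; _:+_; _:*_; con)
  open SetoidReasoning setoid

  x≈y+[x-y] : ∀ x y → x ≈ y + (x - y)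
  x≈y+[x-y] x y = sym (trans (sym (+-assoc y x (- y))) (xyx⁻¹≈y y x))

  a+c≈b+e⇒[a-b]+c≈e : ∀ {a b c e} → a + c ≈ b + e → (a - b) + c ≈ e
  a+c≈b+e⇒[a-b]+c≈e {a} {b} {c} {e} a+c≈b+e = begin
    (a - b) + c  ≈⟨ xy∙z≈xz∙y a (- b) c ⟩
    (a + c) - b  ≈⟨ +-congʳ a+c≈b+e ⟩
    (b + e) - b  ≈⟨ xyx⁻¹≈y b e ⟩
    e            ∎

  [a*d]*z≈0 : ∀ a {d} z → d ≈ 0# → (a * d) * z ≈ 0#
  [a*d]*z≈0 a z d≈0 = trans (*-congʳ (trans (*-congˡ d≈0) (zeroʳ a))) (zeroˡ z)

  difference : Point K → Carrier
  difference (x , y , _) = x - y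

  Plane : ℕ → Point K → Set ℓ
  Plane n (x , y , z) = (x - y) + natR K n * z ≈ 0#

  -- Writing x = y + d removes all subtractions, leaving an identity of commutative semirings.
  T-difference-identity : ∀ x y z m →
    difference (T K (x , y , z)) + (1# + m) * ((x - y) * (z * z))
      ≈ ((x - y) * z) * ((x - y) + m * z)
  T-difference-identity x y z m = a+c≈b+e⇒[a-b]+c≈e (begin
    ((x + z) * d) * z + (1# + m) * (d * (z * z))
      ≈⟨ +-congʳ (*-congʳ (*-congʳ (+-congʳ (x≈y+[x-y] x y)))) ⟩
    (((y + d) + z) * d) * z + (1# + m) * (d * (z * z))
      ≈⟨ semiring-identity y d z m ⟩
    ((y + (z + z)) * d) * z + (d * z) * (d + m * z)  ∎)
    where
    d : Carrier
    d = x - y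

    semiring-identity : ∀ y d z m →
      (((y + d) + z) * d) * z + (1# + m) * (d * (z * z))
        ≈ ((y + (z + z)) * d) * z + (d * z) * (d + m * z)
    semiring-identity = solve 4 (λ y d z m →
      (((y :+ d) :+ z) :* d) :* z :+ (con 1 :+ m) :* (d :* (z :* z))
        := ((y :+ (z :+ z)) :* d) :* z :+ (d :* z) :* (d :+ m :* z)) refl

  T-Plane : ∀ n P → Plane n P → Plane (suc n) (T K P)
  T-Plane n (x , y , z) onPlane = begin
    _                                          ≈⟨ T-difference-identity x y z (natR K n) ⟩
    ((x - y) * z) * ((x - y) + natR K n * z)  ≈⟨ *-congˡ onPlane ⟩
    ((x - y) * z) * 0#                         ≈⟨ zeroʳ _ ⟩
    0#                                         ∎

  iterT-Plane : ∀ k P → Plane 1 P → Plane (suc k) (iterT K k P)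
  iterT-Plane zero    P onY = onY
  iterT-Plane (suc k) P onY = T-Plane (suc k) (iterT K k P) (iterT-Plane k P onY)

  x+z≈y⇒Plane₁ : ∀ {x y z} → x + z ≈ y → Plane 1 (x , y , z)
  x+z≈y⇒Plane₁ {x} {y} {z} x+z≈y = a+c≈b+e⇒[a-b]+c≈e (begin
    x + natR K 1 * z  ≈⟨ +-congˡ (trans (*-congʳ (+-identityʳ 1#)) (*-identityˡ z)) ⟩
    x + z             ≈⟨ x+z≈y ⟩
    y                 ≈⟨ +-identityʳ y ⟨
    y + 0#            ∎)

  Plane-char : ∀ {n} P → natR K n ≈ 0# → Plane n P → difference P ≈ 0#
  Plane-char {n} (x , y , z) n≈0 onPlane = begin
    x - y                    ≈⟨ +-identityʳ (x - y) ⟨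
    (x - y) + 0#             ≈⟨ +-congˡ (zeroˡ z) ⟨
    (x - y) + 0# * z         ≈⟨ +-congˡ (*-congʳ n≈0) ⟨
    (x - y) + natR K n * z   ≈⟨ onPlane ⟩
    0#                       ∎

  T-collapses-diagonal : ∀ P → difference P ≈ 0# → IsOrigin K (T K P)
  T-collapses-diagonal (x , y , z) d≈0 =
    [a*d]*z≈0 (x + z) z d≈0 , [a*d]*z≈0 (y + (z + z)) z d≈0 , trans (*-congʳ d≈0) (zeroˡ (z * z))

  origin-difference : ∀ P → IsOrigin K P → difference P ≈ 0#
  origin-difference (x , y , z) (x≈0 , y≈0 , _) =
    trans (+-cong x≈0 (-‿cong y≈0)) (-‿inverseʳ 0#)

  T-fixes-origin : ∀ P → IsOrigin K P → IsOrigin K (T K P)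
  T-fixes-origin P origin = T-collapses-diagonal P (origin-difference P origin)

  iterT-contracts-Y : ∀ n → natR K (suc n) ≈ 0# → ∀ {x y z} → x + z ≈ y →
                      IsOrigin K (iterT K (suc n) (x , y , z))
  iterT-contracts-Y n char {x} {y} {z} x+z≈y = T-collapses-diagonal Q
    (Plane-char {suc n} Q char (iterT-Plane n (x , y , z) (x+z≈y⇒Plane₁ x+z≈y)))
    where
    Q : Point K
    Q = iterT K n (x , y , z)

mainTheorem3 : ∀ {c ℓ : Level} (p : ℕ) → Prime p →
               (K : CommutativeRing c ℓ) → IsField K → HasChar K p →
               ∀ (x₀ y₀ z₀ : CommutativeRing.Carrier K) →
               CommutativeRing._≈_ K (CommutativeRing._+_ K x₀ z₀) y₀ →
               IsOrigin K (iterT K (suc p) (x₀ , y₀ , z₀))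
mainTheorem3 zero () K _ _ _ _ _ _
mainTheorem3 (suc q) _ K _ char x₀ y₀ z₀ x₀+z₀≈y₀ =
  T-fixes-origin _ (iterT-contracts-Y q char x₀+z₀≈y₀)
  where open Contraction K
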